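{- Let $k\ge1$, $a\in\mathbb{C}$, $\mathbf{x}=(x_1,\dots,x_k)\in\mathbb{C}^k$. Then for all $n\ge0$ $$f_{n+k+1}(\mathbf{x},a)=\sum_{i=0}^{n}\binom{n}{i}f_{n-i+k}(\mathbf{x},a)f_{i+1}(\mathbf{x},a),$$ and for all $n\ge1$, $i\ge1$ $$g_{n,i}(\mathbf{x},a)=\sum_{j=1}^{n-i+1}\binom{n-1}{j-1}f_j(\mathbf{x},a)\,g_{n-j,i-1}(\mathbf{x},a).$$
   Context: The complete exponential Bell polynomials $B_n$ are defined by $\exp\left(\sum_{m\ge1}y_mt^m/m!\right)=\sum_{n\ge0}B_n(y_1,\dots,y_n)t^n/n!$; the partial exponential Bell polynomials $B_{n,i}$ by $\exp\left(u\sum_{j\ge1}y_jt^j/j!\right)=1+\sum_{n\ge1}\frac{t^n}{n!}\sum_{i=1}^n u^iB_{n,i}(y_1,\dots,y_{n-i+1})$. The complete exponential autonomous functions of order $k$ are defined by $f_j(\mathbf{x},a)=x_{j+1}$ for $0\le j\le k-1$, $f_k(\mathbf{x},a)=ae^{x_1}$, and $f_{n+k}(\mathbf{x},a)=ae^{x_1}B_n(f_1(\mathbf{x},a),\dots,f_n(\mathbf{x},a))$ for $n\ge1$. The partial exponential autonomous functions are $g_{n,i}(\mathbf{x},a)=B_{n,i}(f_1(\mathbf{x},a),\dots,f_{n-i+1}(\mathbf{x},a))$, with the conventions $g_{0,0}=1$, $g_{n,0}=0$ for $n\ge1$, and $g_{0,i}=0$ for $i\ge1$. -}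

module Defs where

open import Level using (Level)
open import Algebra.Bundles using (CommutativeRing)
open import Data.Nat using (ℕ; zero; suc; _∸_; _<ᵇ_; _≡ᵇ_; _<?_)
open import Data.Nat.Combinatorics using (_C_)
open import Data.List using (List; []; _∷_; _++_; [_]; length; concatMap; map; foldr)
open import Data.Fin using (Fin; fromℕ<)
open import Data.Bool using (if_then_else_)
open import Relation.Nullary using (yes; no)

-- Set partitions of {1,…,n}, recorded by their list of block sizes.
-- Blocks are listed in order of their least element; a partition of
-- {1,…,n+1} arises uniquely from one of {1,…,n} by either adding n+1
-- as a new singleton block or inserting it into one existing block.
-- Hence 'setPartitions n' enumerates every set partition of [n] exactly
-- once (as its multiset/list of block sizes).

bumps : List ℕ → List (List ℕ)
bumps []      = []
bumps (b ∷ p) = (suc b ∷ p) ∷ map (b ∷_) (bumps p)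

setPartitions : ℕ → List (List ℕ)
setPartitions zero    = [] ∷ []
setPartitions (suc n) = concatMap (λ p → (p ++ [ 1 ]) ∷ bumps p) (setPartitions n)

module _ {c ℓ : Level} (R : CommutativeRing c ℓ) where
  open CommutativeRing R

  sumL : List Carrier → Carrier
  sumL = foldr _+_ 0#

  Σ< : ℕ → (ℕ → Carrier) → Carrier
  Σ< zero    h = 0#
  Σ< (suc n) h = Σ< n h + h n

  natMul : ℕ → Carrier → Carrier
  natMul zero    r = 0#
  natMul (suc n) r = r + natMul n r

  prodBlocks : (ℕ → Carrier) → List ℕ → Carrier
  prodBlocks y = foldr (λ b r → y b * r) 1#

  completeBell : ℕ → (ℕ → Carrier) → Carrier
  completeBell n y = sumL (map (prodBlocks y) (setPartitions n))

  partialBell : ℕ → ℕ → (ℕ → Carrier) → Carrier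
  partialBell n i y =
    sumL (map (λ p → if length p ≡ᵇ i then prodBlocks y p else 0#) (setPartitions n))

  -- x_{j+1} for j < k (0-based access into x = (x_1,…,x_k)), 0 otherwise
  xAt : (k : ℕ) → (Fin k → Carrier) → ℕ → Carrier
  xAt k x j with j <? k
  ... | yes p = x (fromℕ< p)
  ... | no _  = 0#

  module _ (exp : Carrier → Carrier) (k : ℕ) (x : Fin k → Carrier) (a : Carrier) where

    aEx : Carrier
    aEx = a * exp (xAt k x 0)

    -- value f_{d+k} given the earlier values 'prev'
    fromDiff : ℕ → (ℕ → Carrier) → Carrier
    fromDiff zero    prev = aEx
    fromDiff (suc n) prev = aEx * completeBell (suc n) prev

    -- f_m computed from prev = (f_0,…,f_{m-1})
    fNew : ℕ → (ℕ → Carrier) → Carrier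
    fNew m prev = if m <ᵇ k then xAt k x m else fromDiff (m ∸ k) prev

    -- fTrunc m j = f_j for j < m, 0 otherwise
    fTrunc : ℕ → ℕ → Carrier
    fTrunc zero    j = 0#
    fTrunc (suc m) j =
      if j <ᵇ m then fTrunc m j else (if j ≡ᵇ m then fNew m (fTrunc m) else 0#)

    f : ℕ → Carrier
    f j = fTrunc (suc j) j

    g : ℕ → ℕ → Carrier
    g zero    zero    = 1#
    g (suc n) zero    = 0#
    g zero    (suc i) = 0#
    g (suc n) (suc i) = partialBell (suc n) (suc i) f

{-# OPTIONS --safe #-}
module Submission where

-- A set partition grows one element at a time, and each new element either joins the first block or goes
-- into the remaining ones. So for a weight of the form y(size of first block) · w(rest), the partitions got
-- by adding n elements to the block list b ∷ v weigh Σ_j C(n,j) y(b+j) W_v(n-j) in total, where W_v(m) is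
-- the weight of adding m elements to v; Pascal's rule carries the induction on n. Starting from the
-- partition {{1}} this gives B_{n+1} = Σ_j C(n,j) y_{j+1} B_{n-j} and B_{n+1,i+1} = Σ_j C(n,j) y_{j+1} B_{n-j,i}.
-- The first identity then follows from f_{m+k} = a e^{x_1} B_m(f_1,…,f_m), which also holds for m = 0; in
-- the second, the terms with n - j < i vanish since fewer than i elements have no partition into i blocks.

open import Defs
open import Algebra.Bundles using (CommutativeRing)
open import Data.Bool using (true; false; if_then_else_)
open import Data.Fin using (Fin)
open import Data.List using (List; []; _∷_; _++_; [_]; length; map; concatMap)
open import Data.List.Properties using (concatMap-++; concatMap-pure; ++-identityʳ; length-++; map-∘)
open import Data.List.Relation.Unary.All as All using (All; []; _∷_)
open import Data.List.Relation.Unary.All.Properties using (++⁺; map⁺; concat⁺)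
open import Data.Nat using (ℕ; zero; suc; _+_; _∸_; _≤_; _<_; z≤n; s≤s; _<ᵇ_; _≡ᵇ_; _<?_; _≟_)
open import Data.Nat.Combinatorics using (_C_; nCk+nC[k+1]≡[n+1]C[k+1]; k>n⇒nCk≡0)
import Data.Nat.Properties as ℕ
open import Data.Product using (_×_; _,_)
open import Data.Sum using (inj₁; inj₂)
open import Function using (_∘_)
open import Level using (Level)
open import Relation.Nullary.Decidable using (dec-true; dec-false)
import Relation.Binary.PropositionalEquality as ≡
open ≡ using (_≡_; _≢_)

private
  variable
    A B : Set

<ᵇ-true : ∀ {m n} → m < n → (m <ᵇ n) ≡ true
<ᵇ-true {m} {n} = dec-true (m <? n)

<ᵇ-false : ∀ {m n} → n ≤ m → (m <ᵇ n) ≡ false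
<ᵇ-false {m} {n} n≤m = dec-false (m <? n) (ℕ.≤⇒≯ n≤m)

≡ᵇ-refl : ∀ n → (n ≡ᵇ n) ≡ true
≡ᵇ-refl n = dec-true (n ≟ n) ≡.refl

≡ᵇ-false : ∀ {m n} → m ≢ n → (m ≡ᵇ n) ≡ false
≡ᵇ-false {m} {n} = dec-false (m ≟ n)

1+n∸i≤j⇒n∸j<i : ∀ {n i j} → j ≤ n → suc n ∸ i ≤ j → n ∸ j < i
1+n∸i≤j⇒n∸j<i {n} {i} {j} j≤n 1+n∸i≤j = begin
  suc (n ∸ j)   ≡⟨ ℕ.+-∸-assoc 1 j≤n ⟨
  suc n ∸ j     ≤⟨ ℕ.m≤n+o⇒m∸n≤o (suc n) j 1+n≤j+i ⟩
  i             ∎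
  where
  open ℕ.≤-Reasoning
  1+n≤j+i : suc n ≤ j + i
  1+n≤j+i = begin
    suc n               ≤⟨ ℕ.m≤n+m∸n (suc n) i ⟩
    i + (suc n ∸ i)     ≤⟨ ℕ.+-monoʳ-≤ i 1+n∸i≤j ⟩
    i + j               ≡⟨ ℕ.+-comm i j ⟩
    j + i               ∎

concatMap-concatMap : ∀ {C : Set} (g : B → List C) (f : A → List B) xs →
  concatMap g (concatMap f xs) ≡ concatMap (concatMap g ∘ f) xs
concatMap-concatMap g f []       = ≡.refl
concatMap-concatMap g f (x ∷ xs) =
  ≡.trans (concatMap-++ g (f x) (concatMap f xs))
          (≡.cong (concatMap g (f x) ++_) (concatMap-concatMap g f xs))

extendByOne : List ℕ → List (List ℕ)
extendByOne p = (p ++ [ 1 ]) ∷ bumps p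

extensions : ℕ → List ℕ → List (List ℕ)
extensions zero    p = [ p ]
extensions (suc n) p = concatMap (extensions n) (extendByOne p)

concatMap-extensions : ∀ m n → concatMap (extensions n) (setPartitions m) ≡ setPartitions (m + n)
concatMap-extensions m zero    =
  ≡.trans (concatMap-pure (setPartitions m)) (≡.cong setPartitions (≡.sym (ℕ.+-identityʳ m)))
concatMap-extensions m (suc n) = begin
  concatMap (extensions (suc n)) (setPartitions m)
    ≡⟨ concatMap-concatMap (extensions n) extendByOne (setPartitions m) ⟨
  concatMap (extensions n) (setPartitions (suc m))
    ≡⟨ concatMap-extensions (suc m) n ⟩
  setPartitions (suc m + n)
    ≡⟨ ≡.cong setPartitions (ℕ.+-suc m n) ⟨
  setPartitions (m + suc n) ∎
  where open ≡.≡-Reasoning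

extensions-[] : ∀ n → extensions n [] ≡ setPartitions n
extensions-[] n = ≡.trans (≡.sym (++-identityʳ (extensions n []))) (concatMap-extensions 0 n)

extensions-[1] : ∀ n → extensions n [ 1 ] ≡ setPartitions (suc n)
extensions-[1] n = ≡.trans (≡.sym (++-identityʳ (extensions n [ 1 ]))) (concatMap-extensions 1 n)

setPartitions-invariant : (P : ℕ → List ℕ → Set) → P 0 [] →
  (∀ {n p} → P n p → All (P (suc n)) (extendByOne p)) → ∀ n → All (P n) (setPartitions n)
setPartitions-invariant P P[] P-step zero    = P[] ∷ []
setPartitions-invariant P P[] P-step (suc n) =
  concat⁺ (map⁺ (All.map P-step (setPartitions-invariant P P[] P-step n)))

bumps-length : ∀ p → All (λ q → length q ≡ length p) (bumps p)
bumps-length []      = []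
bumps-length (b ∷ p) = ≡.refl ∷ map⁺ (All.map (≡.cong suc) (bumps-length p))

bumps-nonempty : ∀ p → All (λ q → 1 ≤ length q) (bumps p)
bumps-nonempty []      = []
bumps-nonempty (b ∷ p) = s≤s z≤n ∷ map⁺ (All.universal (λ _ → s≤s z≤n) (bumps p))

bumps-blocks≤ : ∀ {n} p → All (_≤ n) p → All (All (_≤ suc n)) (bumps p)
bumps-blocks≤ []      []               = []
bumps-blocks≤ (b ∷ p) (b≤n ∷ blocks≤n) =
  (s≤s b≤n ∷ All.map ℕ.m≤n⇒m≤1+n blocks≤n) ∷
  map⁺ (All.map (ℕ.m≤n⇒m≤1+n b≤n ∷_) (bumps-blocks≤ p blocks≤n))

length-++-[1] : ∀ (p : List ℕ) → length (p ++ [ 1 ]) ≡ suc (length p)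
length-++-[1] p = ≡.trans (length-++ p) (ℕ.+-comm (length p) 1)

extendByOne-length≤ : ∀ p → All (λ q → length q ≤ suc (length p)) (extendByOne p)
extendByOne-length≤ p =
  ℕ.≤-reflexive (length-++-[1] p) ∷
  All.map (λ eq → ℕ.≤-trans (ℕ.≤-reflexive eq) (ℕ.n≤1+n (length p))) (bumps-length p)

extendByOne-nonempty : ∀ p → All (λ q → 1 ≤ length q) (extendByOne p)
extendByOne-nonempty p = ≡.subst (1 ≤_) (≡.sym (length-++-[1] p)) (s≤s z≤n) ∷ bumps-nonempty p

extendByOne-blocks≤ : ∀ {n p} → All (_≤ n) p → All (All (_≤ suc n)) (extendByOne p)
extendByOne-blocks≤ {p = p} blocks≤n =
  ++⁺ (All.map ℕ.m≤n⇒m≤1+n blocks≤n) (s≤s z≤n ∷ []) ∷ bumps-blocks≤ p blocks≤n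

setPartitions-length≤ : ∀ n → All (λ p → length p ≤ n) (setPartitions n)
setPartitions-length≤ = setPartitions-invariant (λ n p → length p ≤ n) z≤n
  (λ {_} {p} length≤n → All.map (λ le → ℕ.≤-trans le (s≤s length≤n)) (extendByOne-length≤ p))

setPartitions-nonempty : ∀ n → All (λ p → 1 ≤ length p) (setPartitions (suc n))
setPartitions-nonempty n = concat⁺ (map⁺ (All.universal extendByOne-nonempty (setPartitions n)))

setPartitions-blocks≤ : ∀ n → All (All (_≤ n)) (setPartitions n)
setPartitions-blocks≤ = setPartitions-invariant (λ n → All (_≤ n)) [] extendByOne-blocks≤

module _ {c ℓ : Level} (R : CommutativeRing c ℓ) where
  open CommutativeRing R renaming (_+_ to _+ᴿ_)
  open import Algebra.Properties.CommutativeSemigroup +-commutativeSemigroup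
    using (interchange; x∙yz≈y∙xz)
  open import Algebra.Properties.CommutativeSemigroup *-commutativeSemigroup
    using () renaming (x∙yz≈y∙xz to x*yz≈y*xz)
  open import Relation.Binary.Reasoning.Setoid setoid

  sumOver : (A → Carrier) → List A → Carrier
  sumOver φ xs = sumL R (map φ xs)

  sumOver-++ : ∀ (φ : A → Carrier) xs ys → sumOver φ (xs ++ ys) ≈ sumOver φ xs +ᴿ sumOver φ ys
  sumOver-++ φ []       ys = sym (+-identityˡ _)
  sumOver-++ φ (x ∷ xs) ys = trans (+-congˡ (sumOver-++ φ xs ys)) (sym (+-assoc _ _ _))

  sumOver-concatMap : ∀ (φ : B → Carrier) (h : A → List B) xs →
    sumOver φ (concatMap h xs) ≈ sumOver (sumOver φ ∘ h) xs
  sumOver-concatMap φ h []       = refl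
  sumOver-concatMap φ h (x ∷ xs) =
    trans (sumOver-++ φ (h x) (concatMap h xs)) (+-congˡ (sumOver-concatMap φ h xs))

  sumOver-map : ∀ (φ : B → Carrier) (h : A → B) xs → sumOver φ (map h xs) ≡ sumOver (φ ∘ h) xs
  sumOver-map φ h xs = ≡.cong (sumL R) (≡.sym (map-∘ xs))

  sumOver-cong : ∀ {φ ψ : A → Carrier} {xs} → All (λ x → φ x ≈ ψ x) xs → sumOver φ xs ≈ sumOver ψ xs
  sumOver-cong []       = refl
  sumOver-cong (e ∷ es) = +-cong e (sumOver-cong es)

  sumOver-vanishes : ∀ {φ : A → Carrier} {xs} → All (λ x → φ x ≈ 0#) xs → sumOver φ xs ≈ 0#
  sumOver-vanishes []       = refl
  sumOver-vanishes (e ∷ es) = trans (+-cong e (sumOver-vanishes es)) (+-identityˡ 0#)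

  sumOver-*ˡ : ∀ a (φ : A → Carrier) xs → sumOver (λ x → a * φ x) xs ≈ a * sumOver φ xs
  sumOver-*ˡ a φ []       = sym (zeroʳ a)
  sumOver-*ˡ a φ (x ∷ xs) = trans (+-congˡ (sumOver-*ˡ a φ xs)) (sym (distribˡ a _ _))

  Σ<-cong : ∀ N {h h′ : ℕ → Carrier} → (∀ j → j < N → h j ≈ h′ j) → Σ< R N h ≈ Σ< R N h′
  Σ<-cong zero    eq = refl
  Σ<-cong (suc N) eq = +-cong (Σ<-cong N (λ j j<N → eq j (ℕ.m<n⇒m<1+n j<N))) (eq N ℕ.≤-refl)

  Σ<-zero : ∀ N → Σ< R N (λ _ → 0#) ≈ 0#
  Σ<-zero zero    = refl
  Σ<-zero (suc N) = trans (+-identityʳ _) (Σ<-zero N)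

  Σ<-+ : ∀ N h h′ → Σ< R N (λ j → h j +ᴿ h′ j) ≈ Σ< R N h +ᴿ Σ< R N h′
  Σ<-+ zero    h h′ = sym (+-identityˡ 0#)
  Σ<-+ (suc N) h h′ = trans (+-congʳ (Σ<-+ N h h′)) (interchange _ _ _ _)

  Σ<-*ˡ : ∀ N a h → a * Σ< R N h ≈ Σ< R N (λ j → a * h j)
  Σ<-*ˡ zero    a h = zeroʳ a
  Σ<-*ˡ (suc N) a h = trans (distribˡ a _ _) (+-congʳ (Σ<-*ˡ N a h))

  Σ<-suc : ∀ N h → Σ< R (suc N) h ≈ h 0 +ᴿ Σ< R N (h ∘ suc)
  Σ<-suc zero    h = trans (+-identityˡ _) (sym (+-identityʳ _))
  Σ<-suc (suc N) h = trans (+-congʳ (Σ<-suc N h)) (+-assoc _ _ _)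

  Σ<-truncate : ∀ {M} N h → M ≤ N → (∀ j → M ≤ j → j < N → h j ≈ 0#) → Σ< R N h ≈ Σ< R M h
  Σ<-truncate N h M≤N vanish with ℕ.m≤n⇒m<n∨m≡n M≤N
  Σ<-truncate N       h _ vanish | inj₂ ≡.refl     = refl
  Σ<-truncate (suc N) h _ vanish | inj₁ (s≤s M≤N) =
    trans (+-cong (Σ<-truncate N h M≤N (λ j M≤j j<N → vanish j M≤j (ℕ.m<n⇒m<1+n j<N)))
                  (vanish N M≤N ℕ.≤-refl))
          (+-identityʳ _)

  sumOver-Σ< : ∀ N (H : A → ℕ → Carrier) xs →
    sumOver (λ x → Σ< R N (H x)) xs ≈ Σ< R N (λ j → sumOver (λ x → H x j) xs)
  sumOver-Σ< N H []       = sym (Σ<-zero N)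
  sumOver-Σ< N H (x ∷ xs) = trans (+-congˡ (sumOver-Σ< N H xs)) (sym (Σ<-+ N (H x) _))

  natMul-congʳ : ∀ n {x y} → x ≈ y → natMul R n x ≈ natMul R n y
  natMul-congʳ zero    x≈y = refl
  natMul-congʳ (suc n) x≈y = +-cong x≈y (natMul-congʳ n x≈y)

  natMul-congˡ : ∀ {m n x} → m ≡ n → natMul R m x ≈ natMul R n x
  natMul-congˡ ≡.refl = refl

  natMul-+ : ∀ m n x → natMul R (m + n) x ≈ natMul R m x +ᴿ natMul R n x
  natMul-+ zero    n x = sym (+-identityˡ _)
  natMul-+ (suc m) n x = trans (+-congˡ (natMul-+ m n x)) (sym (+-assoc _ _ _))

  natMul-*-assoc : ∀ n x y → natMul R n x * y ≈ natMul R n (x * y)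
  natMul-*-assoc zero    x y = zeroˡ y
  natMul-*-assoc (suc n) x y = trans (distribʳ y x _) (+-congˡ (natMul-*-assoc n x y))

  binomialConvolution : (ℕ → Carrier) → (ℕ → Carrier) → ℕ → Carrier
  binomialConvolution c d n = Σ< R (suc n) (λ j → natMul R (n C j) (c j) * d (n ∸ j))

  binomialConvolution-cong : ∀ {c c′ d d′} → (∀ j → c j ≈ c′ j) → (∀ m → d m ≈ d′ m) →
    ∀ n → binomialConvolution c d n ≈ binomialConvolution c′ d′ n
  binomialConvolution-cong c≈c′ d≈d′ n =
    Σ<-cong (suc n) (λ j _ → *-cong (natMul-congʳ (n C j) (c≈c′ j)) (d≈d′ (n ∸ j)))

  binomialConvolution-suc : ∀ c d n →
    binomialConvolution c d (suc n) ≈ binomialConvolution (c ∘ suc) d n +ᴿ binomialConvolution c (d ∘ suc) n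
  binomialConvolution-suc c d n = begin
    Σ< R (suc (suc n)) (λ j → natMul R (suc n C j) (c j) * d (suc n ∸ j))
      ≈⟨ Σ<-suc (suc n) _ ⟩
    t 0 +ᴿ Σ< R (suc n) (λ j → natMul R (suc n C suc j) (c (suc j)) * d (n ∸ j))
      ≈⟨ +-congˡ (Σ<-cong (suc n) (λ j _ → pascal j)) ⟩
    t 0 +ᴿ Σ< R (suc n) (λ j → natMul R (n C j) (c (suc j)) * d (n ∸ j) +ᴿ t (suc j))
      ≈⟨ +-congˡ (Σ<-+ (suc n) _ _) ⟩
    t 0 +ᴿ (binomialConvolution (c ∘ suc) d n +ᴿ Σ< R (suc n) (t ∘ suc))
      ≈⟨ x∙yz≈y∙xz _ _ _ ⟩
    binomialConvolution (c ∘ suc) d n +ᴿ (t 0 +ᴿ Σ< R (suc n) (t ∘ suc))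
      ≈⟨ +-congˡ (sym (Σ<-suc (suc n) t)) ⟩
    binomialConvolution (c ∘ suc) d n +ᴿ Σ< R (suc (suc n)) t
      ≈⟨ +-congˡ (Σ<-truncate (suc (suc n)) t (ℕ.n≤1+n (suc n)) last-vanishes) ⟩
    binomialConvolution (c ∘ suc) d n +ᴿ Σ< R (suc n) t
      ≈⟨ +-congˡ (Σ<-cong (suc n) (λ j j<1+n →
           *-congˡ (reflexive (≡.cong d (ℕ.+-∸-assoc 1 (ℕ.m<1+n⇒m≤n j<1+n)))))) ⟩
    binomialConvolution (c ∘ suc) d n +ᴿ binomialConvolution c (d ∘ suc) n ∎
    where
    t : ℕ → Carrier
    t j = natMul R (n C j) (c j) * d (suc n ∸ j)

    pascal : ∀ j → natMul R (suc n C suc j) (c (suc j)) * d (n ∸ j)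
                   ≈ natMul R (n C j) (c (suc j)) * d (n ∸ j) +ᴿ t (suc j)
    pascal j = trans (*-congʳ (trans (natMul-congˡ (≡.sym (nCk+nC[k+1]≡[n+1]C[k+1] n j)))
                                     (natMul-+ (n C j) (n C suc j) (c (suc j)))))
                     (distribʳ _ _ _)

    last-vanishes : ∀ j → suc n ≤ j → j < suc (suc n) → t j ≈ 0#
    last-vanishes j n<j j≤1+n with ℕ.≤-antisym n<j (ℕ.m<1+n⇒m≤n j≤1+n)
    ... | ≡.refl = trans (*-congʳ (natMul-congˡ (k>n⇒nCk≡0 (ℕ.n<1+n n)))) (zeroˡ _)

  binomialConvolution-truncate : ∀ {i} c d n → (∀ m → m < i → d m ≈ 0#) →
    binomialConvolution c d n ≈ Σ< R (suc n ∸ i) (λ j → natMul R (n C j) (c j) * d (n ∸ j))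
  binomialConvolution-truncate {i} c d n d-vanishes =
    Σ<-truncate (suc n) _ (ℕ.m∸n≤m (suc n) i) (λ j 1+n∸i≤j j<1+n →
      trans (*-congˡ (d-vanishes (n ∸ j) (1+n∸i≤j⇒n∸j<i (ℕ.m<1+n⇒m≤n j<1+n) 1+n∸i≤j))) (zeroʳ _))

  sumOver-binomialConvolution : ∀ c (D : A → ℕ → Carrier) n xs →
    sumOver (λ x → binomialConvolution c (D x) n) xs
      ≈ binomialConvolution c (λ m → sumOver (λ x → D x m) xs) n
  sumOver-binomialConvolution c D n xs =
    trans (sumOver-Σ< (suc n) _ xs)
          (Σ<-cong (suc n) (λ j _ → sumOver-*ˡ (natMul R (n C j) (c j)) (λ x → D x (n ∸ j)) xs))

  sumOver-extendByOne-∷ : ∀ (φ : List ℕ → Carrier) b v →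
    sumOver φ (extendByOne (b ∷ v)) ≈ φ (suc b ∷ v) +ᴿ sumOver (φ ∘ (b ∷_)) (extendByOne v)
  sumOver-extendByOne-∷ φ b v =
    trans (+-congˡ (+-congˡ (reflexive (sumOver-map φ (b ∷_) (bumps v))))) (x∙yz≈y∙xz _ _ _)

  module _ (y : ℕ → Carrier) (α β : List ℕ → Carrier) (α-∷ : ∀ b q → α (b ∷ q) ≈ y b * β q) where

    sumOver-extensions-∷ : ∀ n b v →
      sumOver α (extensions n (b ∷ v))
        ≈ binomialConvolution (λ j → y (j + b)) (λ m → sumOver β (extensions m v)) n
    sumOver-extensions-∷ zero b v = begin
      α (b ∷ v) +ᴿ 0#                        ≈⟨ +-identityʳ _ ⟩
      α (b ∷ v)                              ≈⟨ α-∷ b v ⟩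
      y b * β v                              ≈⟨ *-cong (sym (+-identityʳ _)) (sym (+-identityʳ _)) ⟩
      (y b +ᴿ 0#) * (β v +ᴿ 0#)              ≈⟨ sym (+-identityˡ _) ⟩
      binomialConvolution (λ j → y (j + b)) (λ m → sumOver β (extensions m v)) 0 ∎
    sumOver-extensions-∷ (suc n) b v = begin
      sumOver α (extensions (suc n) (b ∷ v))
        ≈⟨ sumOver-concatMap α (extensions n) (extendByOne (b ∷ v)) ⟩
      sumOver E (extendByOne (b ∷ v))
        ≈⟨ sumOver-extendByOne-∷ E b v ⟩
      E (suc b ∷ v) +ᴿ sumOver (λ q → E (b ∷ q)) (extendByOne v)
        ≈⟨ +-cong (sumOver-extensions-∷ n (suc b) v)
                  (sumOver-cong (All.universal (λ q → sumOver-extensions-∷ n b q) (extendByOne v))) ⟩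
      binomialConvolution (λ j → y (j + suc b)) (D v) n
        +ᴿ sumOver (λ q → binomialConvolution (λ j → y (j + b)) (D q) n) (extendByOne v)
        ≈⟨ +-cong (binomialConvolution-cong {d = D v} (λ j → reflexive (≡.cong y (ℕ.+-suc j b)))
                                                      (λ _ → refl) n)
                  (sumOver-binomialConvolution _ D n (extendByOne v)) ⟩
      binomialConvolution (λ j → y (suc j + b)) (D v) n
        +ᴿ binomialConvolution (λ j → y (j + b)) (λ m → sumOver (λ q → D q m) (extendByOne v)) n
        ≈⟨ +-congˡ (binomialConvolution-cong (λ _ → refl)
                      (λ m → sym (sumOver-concatMap β (extensions m) (extendByOne v))) n) ⟩
      binomialConvolution (λ j → y (suc j + b)) (D v) n
        +ᴿ binomialConvolution (λ j → y (j + b)) (D v ∘ suc) n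
        ≈⟨ sym (binomialConvolution-suc (λ j → y (j + b)) (D v) n) ⟩
      binomialConvolution (λ j → y (j + b)) (D v) (suc n) ∎
      where
      E : List ℕ → Carrier
      E p = sumOver α (extensions n p)
      D : List ℕ → ℕ → Carrier
      D q m = sumOver β (extensions m q)

    sumOver-setPartitions-suc : ∀ n →
      sumOver α (setPartitions (suc n))
        ≈ binomialConvolution (λ j → y (j + 1)) (λ m → sumOver β (setPartitions m)) n
    sumOver-setPartitions-suc n = begin
      sumOver α (setPartitions (suc n))
        ≡⟨ ≡.cong (sumOver α) (extensions-[1] n) ⟨
      sumOver α (extensions n [ 1 ])
        ≈⟨ sumOver-extensions-∷ n 1 [] ⟩
      binomialConvolution (λ j → y (j + 1)) (λ m → sumOver β (extensions m [])) n
        ≈⟨ binomialConvolution-cong (λ _ → refl)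
             (λ m → reflexive (≡.cong (sumOver β) (extensions-[] m))) n ⟩
      binomialConvolution (λ j → y (j + 1)) (λ m → sumOver β (setPartitions m)) n ∎

  completeBell-suc : ∀ n y →
    completeBell R (suc n) y ≈ binomialConvolution (λ j → y (j + 1)) (λ m → completeBell R m y) n
  completeBell-suc n y = sumOver-setPartitions-suc y (prodBlocks R y) (prodBlocks R y) (λ _ _ → refl) n

  prodBlocksOfLength : ℕ → (ℕ → Carrier) → List ℕ → Carrier
  prodBlocksOfLength i y p = if length p ≡ᵇ i then prodBlocks R y p else 0#

  prodBlocksOfLength-∷ : ∀ i y b q →
    prodBlocksOfLength (suc i) y (b ∷ q) ≈ y b * prodBlocksOfLength i y q
  prodBlocksOfLength-∷ i y b q with length q ≡ᵇ i
  ... | true  = refl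
  ... | false = sym (zeroʳ (y b))

  prodBlocksOfLength-≢ : ∀ {i} y p → length p ≢ i → prodBlocksOfLength i y p ≈ 0#
  prodBlocksOfLength-≢ y p length≢i rewrite ≡ᵇ-false length≢i = refl

  partialBell-suc : ∀ n i y →
    partialBell R (suc n) (suc i) y
      ≈ binomialConvolution (λ j → y (j + 1)) (λ m → partialBell R m i y) n
  partialBell-suc n i y = sumOver-setPartitions-suc y
    (prodBlocksOfLength (suc i) y) (prodBlocksOfLength i y) (prodBlocksOfLength-∷ i y) n

  partialBell-vanishes : ∀ {n i} y → n < i → partialBell R n i y ≈ 0#
  partialBell-vanishes {n} y n<i = sumOver-vanishes (All.map
    (λ {p} length≤n → prodBlocksOfLength-≢ y p (λ length≡i →
       ℕ.<⇒≱ n<i (ℕ.≤-trans (ℕ.≤-reflexive (≡.sym length≡i)) length≤n)))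
    (setPartitions-length≤ n))

  partialBell-0 : ∀ n y → partialBell R (suc n) 0 y ≈ 0#
  partialBell-0 n y = sumOver-vanishes (All.map
    (λ {p} 1≤length → prodBlocksOfLength-≢ y p (λ length≡0 →
       ℕ.<⇒≱ 1≤length (ℕ.≤-reflexive length≡0)))
    (setPartitions-nonempty n))

  prodBlocks-cong : ∀ {y y′ : ℕ → Carrier} {p} → All (λ b → y b ≈ y′ b) p →
    prodBlocks R y p ≈ prodBlocks R y′ p
  prodBlocks-cong []         = refl
  prodBlocks-cong (e ∷ es) = *-cong e (prodBlocks-cong es)

  completeBell-cong : ∀ n {y y′ : ℕ → Carrier} → (∀ b → b ≤ n → y b ≈ y′ b) →
    completeBell R n y ≈ completeBell R n y′
  completeBell-cong n y≈y′ =
    sumOver-cong (All.map (λ blocks≤n → prodBlocks-cong (All.map (y≈y′ _) blocks≤n))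
                          (setPartitions-blocks≤ n))

  module _ (exp : Carrier → Carrier) (k : ℕ) (x : Fin k → Carrier) (a : Carrier) where

    private
      F : ℕ → Carrier
      F = f R exp k x a

      G : ℕ → ℕ → Carrier
      G = g R exp k x a

    fTrunc-below : ∀ {m j} → j < m → fTrunc R exp k x a m j ≡ F j
    fTrunc-below {suc m} {j} j<1+m with ℕ.m<1+n⇒m<n∨m≡n j<1+m
    ... | inj₁ j<m rewrite <ᵇ-true j<m = fTrunc-below j<m
    ... | inj₂ ≡.refl                  = ≡.refl

    f-unfold : ∀ j → F j ≡ fNew R exp k x a j (fTrunc R exp k x a j)
    f-unfold j rewrite <ᵇ-false (ℕ.≤-refl {j}) | ≡ᵇ-refl j = ≡.refl

    fNew-+k : ∀ m prev → fNew R exp k x a (m + k) prev ≡ fromDiff R exp k x a m prev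
    fNew-+k m prev = ≡.trans
      (≡.cong (λ b → if b then xAt R k x (m + k) else fromDiff R exp k x a (m + k ∸ k) prev)
              (<ᵇ-false (ℕ.m≤n+m k m)))
      (≡.cong (λ d → fromDiff R exp k x a d prev) (ℕ.m+n∸n≡m m k))

    f-+k : 1 ≤ k → ∀ m → F (m + k) ≈ aEx R exp k x a * completeBell R m F
    f-+k _ zero = begin
      F k                                   ≡⟨ ≡.trans (f-unfold k) (fNew-+k 0 _) ⟩
      aEx R exp k x a                       ≈⟨ *-identityʳ _ ⟨
      aEx R exp k x a * 1#                  ≈⟨ *-congˡ (+-identityʳ 1#) ⟨
      aEx R exp k x a * completeBell R 0 F  ∎
    f-+k 1≤k (suc m) = begin
      F (suc m + k)
        ≡⟨ ≡.trans (f-unfold (suc m + k)) (fNew-+k (suc m) _) ⟩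
      aEx R exp k x a * completeBell R (suc m) (fTrunc R exp k x a (suc m + k))
        ≈⟨ *-congˡ (completeBell-cong (suc m) (λ b b≤1+m →
             reflexive (fTrunc-below (ℕ.≤-<-trans b≤1+m (ℕ.m<m+n (suc m) 1≤k))))) ⟩
      aEx R exp k x a * completeBell R (suc m) F ∎

    f-recurrence : 1 ≤ k → ∀ n →
      F (n + k + 1) ≈ Σ< R (suc n) (λ i → natMul R (n C i) (F (n ∸ i + k) * F (i + 1)))
    f-recurrence 1≤k n = begin
      F (n + k + 1)
        ≡⟨ ≡.cong F (ℕ.+-comm (n + k) 1) ⟩
      F (suc n + k)
        ≈⟨ f-+k 1≤k (suc n) ⟩
      aEx R exp k x a * completeBell R (suc n) F
        ≈⟨ *-congˡ (completeBell-suc n F) ⟩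
      aEx R exp k x a * binomialConvolution (λ j → F (j + 1)) (λ m → completeBell R m F) n
        ≈⟨ Σ<-*ˡ (suc n) _ _ ⟩
      Σ< R (suc n) (λ j → aEx R exp k x a * (natMul R (n C j) (F (j + 1)) * completeBell R (n ∸ j) F))
        ≈⟨ Σ<-cong (suc n) (λ j _ → term j) ⟩
      Σ< R (suc n) (λ i → natMul R (n C i) (F (n ∸ i + k) * F (i + 1))) ∎
      where
      term : ∀ j → aEx R exp k x a * (natMul R (n C j) (F (j + 1)) * completeBell R (n ∸ j) F)
                   ≈ natMul R (n C j) (F (n ∸ j + k) * F (j + 1))
      term j = begin
        aEx R exp k x a * (natMul R (n C j) (F (j + 1)) * completeBell R (n ∸ j) F)
          ≈⟨ x*yz≈y*xz _ _ _ ⟩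
        natMul R (n C j) (F (j + 1)) * (aEx R exp k x a * completeBell R (n ∸ j) F)
          ≈⟨ *-congˡ (f-+k 1≤k (n ∸ j)) ⟨
        natMul R (n C j) (F (j + 1)) * F (n ∸ j + k)
          ≈⟨ natMul-*-assoc (n C j) _ _ ⟩
        natMul R (n C j) (F (j + 1) * F (n ∸ j + k))
          ≈⟨ natMul-congʳ (n C j) (*-comm _ _) ⟩
        natMul R (n C j) (F (n ∸ j + k) * F (j + 1)) ∎

    partialBell≈g : ∀ m i → partialBell R m i F ≈ G m i
    partialBell≈g zero    zero    = +-identityʳ 1#
    partialBell≈g zero    (suc i) = +-identityʳ 0#
    partialBell≈g (suc m) zero    = partialBell-0 m F
    partialBell≈g (suc m) (suc i) = refl

    g-recurrence : ∀ n i → 1 ≤ n → 1 ≤ i →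
      G n i ≈ Σ< R (suc n ∸ i) (λ j′ → natMul R ((n ∸ 1) C j′) (F (j′ + 1) * G (n ∸ (j′ + 1)) (i ∸ 1)))
    g-recurrence (suc n) (suc i) _ _ = begin
      G (suc n) (suc i)
        ≈⟨ partialBell-suc n i F ⟩
      binomialConvolution (λ j → F (j + 1)) (λ m → partialBell R m i F) n
        ≈⟨ binomialConvolution-truncate _ _ n (λ m m<i → partialBell-vanishes F m<i) ⟩
      Σ< R (suc n ∸ i) (λ j → natMul R (n C j) (F (j + 1)) * partialBell R (n ∸ j) i F)
        ≈⟨ Σ<-cong (suc n ∸ i) (λ j _ → term j) ⟩
      Σ< R (suc n ∸ i) (λ j → natMul R (n C j) (F (j + 1) * G (suc n ∸ (j + 1)) i)) ∎
      where
      term : ∀ j → natMul R (n C j) (F (j + 1)) * partialBell R (n ∸ j) i F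
                   ≈ natMul R (n C j) (F (j + 1) * G (suc n ∸ (j + 1)) i)
      term j = trans (natMul-*-assoc (n C j) _ _) (natMul-congʳ (n C j) (*-congˡ (begin
        partialBell R (n ∸ j) i F  ≈⟨ partialBell≈g (n ∸ j) i ⟩
        G (n ∸ j) i                ≡⟨ ≡.cong (λ m → G (suc n ∸ m) i) (ℕ.+-comm 1 j) ⟩
        G (suc n ∸ (j + 1)) i      ∎)))

mainTheorem2 : ∀ {c ℓ} (R : CommutativeRing c ℓ) →
    let open CommutativeRing R renaming (_+_ to _+ᴿ_) in
    (exp : Carrier → Carrier) (k : ℕ) → 1 ≤ k →
    (x : Fin k → Carrier) (a : Carrier) →
    (∀ (n : ℕ) →
       f R exp k x a (n + k + 1)
         ≈ Σ< R (suc n) (λ i → natMul R (n C i)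
              (f R exp k x a (n ∸ i + k) * f R exp k x a (i + 1))))
    ×
    (∀ (n i : ℕ) → 1 ≤ n → 1 ≤ i →
       g R exp k x a n i
         ≈ Σ< R (suc n ∸ i) (λ j′ → natMul R ((n ∸ 1) C j′)
              (f R exp k x a (j′ + 1) * g R exp k x a (n ∸ (j′ + 1)) (i ∸ 1))))
mainTheorem2 R exp k 1≤k x a = f-recurrence R exp k x a 1≤k , g-recurrence R exp k x a
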